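{- Let $\mathcal{A}=(Q,E,s,F)$ be an NFA and let $\sim$ be an equivalence relation on $Q$ such that $u\sim v$ implies $I_u=I_v$. Let $\mathcal{A}/_\sim$ be the quotient automaton. Denote by $I^\sim_\alpha$ the set of states of $\mathcal{A}/_\sim$ reached by $\alpha$ and by $I^\sim_{[v]_\sim}$ the set of strings that reach $[v]_\sim$ on $\mathcal{A}/_\sim$. Then: (1) for every $\alpha\in\Sigma^*$ and $v\in Q$, $v\in I_\alpha\iff[v]_\sim\in I^\sim_\alpha$; (2) for every $v\in Q$, $I_v=I^\sim_{[v]_\sim}$; (3) $\mathcal{L}(\mathcal{A}/_\sim)=\mathcal{L}(\mathcal{A})$; (4) the powerset automata obtained from $\mathcal{A}/_\sim$ and from $\mathcal{A}$ are isomorphic.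
   Context: An NFA is $\mathcal{A}=(Q,E,s,F)$ over a finite alphabet $\Sigma$, with finite $Q$, $E\subseteq Q\times Q\times\Sigma$, initial state $s$, final states $F$; every state is reachable from $s$ and can reach a final state. For $u\in Q$, $I_u$ is the set of strings readable from $s$ to $u$; for a string $\alpha$, $I_\alpha$ is the set of states reached from $s$ by reading $\alpha$. The quotient $\mathcal{A}/_\sim=(Q/_\sim,E/_\sim,[s]_\sim,F/_\sim)$ has states the classes $[v]_\sim$, edges $([u]_\sim,[v]_\sim,a)$ whenever $(u',v',a)\in E$ for some $u'\in[u]_\sim,v'\in[v]_\sim$, initial state $[s]_\sim$ (which equals $\{s\}$), and final states the classes containing some final state. The powerset automaton of an NFA $\mathcal{B}$ has states $\{I_\alpha:\alpha\in Pref(\mathcal{L}(\mathcal{B}))\}$, edges $(I_\alpha,I_{\alpha a},a)$ for $\alpha a\in Pref(\mathcal{L}(\mathcal{B}))$, initial state $I_\varepsilon$ and final states $\{I_\alpha:\alpha\in\mathcal{L}(\mathcal{B})\}$ (with $I_\alpha$ computed in $\mathcal{B}$). -}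

module Defs where

open import Data.Nat using (ℕ)
open import Data.Fin using (Fin)
open import Data.List using (List; []; _∷_; _++_; [_])
open import Data.Product using (Σ; ∃; ∃-syntax; _×_; _,_; proj₁)
open import Relation.Binary.PropositionalEquality using (_≡_; isEquivalence)
open import Relation.Binary using (IsEquivalence; Rel)

_⇔_ : Set → Set → Set
A ⇔ B = (A → B) × (B → A)

Word : ℕ → Set
Word k = List (Fin k)

record NFA (k : ℕ) : Set₁ where
  field
    n : ℕ
    E : Fin n → Fin n → Fin k → Set
    s : Fin n
    F : Fin n → Set

-- Used to represent the quotient A/~ : states are the classes [v], i.e. the
-- elements of Q compared by ~ ; an NFA is the special case ≈ = ≡.
record SNFA (k : ℕ) : Set₁ where
  field
    St : Set
    _≈_ : St → St → Set
    isEq : IsEquivalence _≈_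
    E : St → St → Fin k → Set
    s : St
    F : St → Set

module _ {k : ℕ} (B : SNFA k) where
  open SNFA B

  data Path : St → Word k → St → Set where
    nil  : ∀ {u v} → u ≈ v → Path u [] v
    cons : ∀ {u w v a α} → E u w a → Path w α v → Path u (a ∷ α) v

  I : Word k → St → Set
  I α v = Path s α v

  Iv : St → Word k → Set
  Iv v α = Path s α v

  Lang : Word k → Set
  Lang α = ∃[ v ] (Path s α v × F v)

  Pref : Word k → Set
  Pref α = ∃[ β ] Lang (α ++ β)

  -- Powerset automaton: states are the sets I_α (α ∈ Pref(L(B))),
  -- represented by α and compared by equality of the sets I_α.
  PState : Set
  PState = Σ (Word k) Pref

  SameI : PState → Word k → Set
  SameI S γ = ∀ v → I (proj₁ S) v ⇔ I γ v

  _≋_ : PState → PState → Set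
  S ≋ T = SameI S (proj₁ T)

  PEdge : PState → PState → Fin k → Set
  PEdge S T a = ∃[ γ ] (Pref (γ ++ [ a ]) × SameI S γ × SameI T (γ ++ [ a ]))

  PInit : PState → Set
  PInit S = SameI S []

  PFinal : PState → Set
  PFinal S = ∃[ γ ] (Lang γ × SameI S γ)

record PowIso {k : ℕ} (B C : SNFA k) : Set where
  field
    to   : PState B → PState C
    from : PState C → PState B
    to-cong   : ∀ S S′ → _≋_ B S S′ → _≋_ C (to S) (to S′)
    from-cong : ∀ T T′ → _≋_ C T T′ → _≋_ B (from T) (from T′)
    from-to : ∀ S → _≋_ B (from (to S)) S
    to-from : ∀ T → _≋_ C (to (from T)) T
    init  : ∀ S → PInit B S ⇔ PInit C (to S)
    final : ∀ S → PFinal B S ⇔ PFinal C (to S)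
    edge  : ∀ S T a → PEdge B S T a ⇔ PEdge C (to S) (to T) a

toS : ∀ {k} → NFA k → SNFA k
toS A = record
  { St = Fin n ; _≈_ = _≡_ ; isEq = isEquivalence ; E = E ; s = s ; F = F }
  where open NFA A

Trim : ∀ {k} → NFA k → Set
Trim A = ∀ v → ∃[ α ] Path (toS A) (NFA.s A) α v
             × ∃[ β ] ∃[ w ] (Path (toS A) v β w × NFA.F A w)

quot : ∀ {k} (A : NFA k) (_~_ : Rel (Fin (NFA.n A)) _) → IsEquivalence _~_ → SNFA k
quot A _~_ eq = record
  { St = Fin n
  ; _≈_ = _~_
  ; isEq = eq
  ; E = λ u v a → ∃[ u′ ] ∃[ v′ ] (u′ ~ u × v′ ~ v × E u′ v′ a)
  ; s = s
  ; F = λ v → ∃[ v′ ] (v′ ~ v × F v′)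
  }
  where open NFA A

{-# OPTIONS --safe #-}
-- Reading a string in A/~ may jump, at each step, between ~-equivalent states.
-- Since ~-equivalent states are reached by exactly the same strings, such a jump
-- never leaves the set of strings reaching the current state, so every run of
-- A/~ from s can be replayed in A ending in the same state.  Thus A and A/~
-- reach the same states by the same strings; their languages agree, and so do
-- the two powerset automata, which depend only on the language and on which
-- strings reach the same set of states.
module Submission where

open import Defs
open import Data.Nat using (ℕ)
open import Data.Fin using (Fin)
open import Data.Product using (_×_; _,_; proj₁; proj₂)
open import Data.List using ([]; _∷_; _++_; [_])
open import Data.List.Properties using (++-assoc; ++-identityʳ)
open import Relation.Binary using (IsEquivalence; Rel)
open import Relation.Binary.PropositionalEquality using (refl; subst; sym)
open import Level using (0ℓ)

⇔-cong : ∀ {P P′ R R′ : Set} → P ⇔ P′ → R ⇔ R′ → (P ⇔ R) ⇔ (P′ ⇔ R′)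
⇔-cong (p→p′ , p′→p) (r→r′ , r′→r) =
    (λ { (p→r , r→p) → (λ p′ → r→r′ (p→r (p′→p p′))) , (λ r′ → p→p′ (r→p (r′→r r′))) })
  , (λ { (p′→r′ , r′→p′) → (λ p → r′→r (p′→r′ (p→p′ p))) , (λ r → p′→p (r′→p′ (r→r′ r))) })

module _ {k : ℕ} (B : SNFA k) where

  SameReach : Word k → Word k → Set
  SameReach α γ = ∀ v → I B α v ⇔ I B γ v

module _ {k : ℕ} {B C : SNFA k}
  (sameLang : ∀ α → Lang B α ⇔ Lang C α)
  (sameReach : ∀ α γ → SameReach B α γ ⇔ SameReach C α γ) where

  Pref⇔Pref : ∀ α → Pref B α ⇔ Pref C α
  Pref⇔Pref α = (λ { (β , l) → β , proj₁ (sameLang (α ++ β)) l })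
              , (λ { (β , l) → β , proj₂ (sameLang (α ++ β)) l })

  sameLang∧sameReach⇒PowIso : PowIso B C
  sameLang∧sameReach⇒PowIso = record
    { to = λ { (α , p) → α , proj₁ (Pref⇔Pref α) p }
    ; from = λ { (α , p) → α , proj₂ (Pref⇔Pref α) p }
    ; to-cong = λ S S′ → to (proj₁ S) (proj₁ S′)
    ; from-cong = λ T T′ → from (proj₁ T) (proj₁ T′)
    ; from-to = λ _ _ → (λ x → x) , (λ x → x)
    ; to-from = λ _ _ → (λ x → x) , (λ x → x)
    ; init = λ S → sameReach (proj₁ S) []
    ; final = λ S →
          (λ { (γ , l , h) → γ , proj₁ (sameLang γ) l , to (proj₁ S) γ h })
        , (λ { (γ , l , h) → γ , proj₂ (sameLang γ) l , from (proj₁ S) γ h })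
    ; edge = λ S T a →
          (λ { (γ , p , h , h′) → γ , proj₁ (Pref⇔Pref (γ ++ [ a ])) p
                                , to (proj₁ S) γ h , to (proj₁ T) (γ ++ [ a ]) h′ })
        , (λ { (γ , p , h , h′) → γ , proj₂ (Pref⇔Pref (γ ++ [ a ])) p
                                , from (proj₁ S) γ h , from (proj₁ T) (γ ++ [ a ]) h′ })
    }
    where
    to : ∀ α γ → SameReach B α γ → SameReach C α γ
    to α γ = proj₁ (sameReach α γ)
    from : ∀ α γ → SameReach C α γ → SameReach B α γ
    from α γ = proj₂ (sameReach α γ)

path-snoc : ∀ {k} (A : NFA k) {u w v a α} →
  Path (toS A) u α w → NFA.E A w v a → Path (toS A) u (α ++ [ a ]) v
path-snoc A (nil refl) e = cons e (nil refl)
path-snoc A (cons e′ p) e = cons e′ (path-snoc A p e)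

module _ {k : ℕ} (A : NFA k) (_~_ : Rel (Fin (NFA.n A)) 0ℓ) (eq : IsEquivalence _~_) where
  open IsEquivalence eq using () renaming (refl to ~-refl)

  path⇒quotPath : ∀ {u α v} → Path (toS A) u α v → Path (quot A _~_ eq) u α v
  path⇒quotPath (nil refl) = nil ~-refl
  path⇒quotPath (cons e p) = cons (_ , _ , ~-refl , ~-refl , e) (path⇒quotPath p)

  module _ (~⇒sameIv : ∀ u v → u ~ v → ∀ α → Iv (toS A) u α ⇔ Iv (toS A) v α) where

    ~-transport : ∀ {u v} → u ~ v → ∀ {α} → I (toS A) α u → I (toS A) α v
    ~-transport {u} {v} u~v {α} = proj₁ (~⇒sameIv u v u~v α)

    ~-transport⁻ : ∀ {u v} → u ~ v → ∀ {α} → I (toS A) α v → I (toS A) α u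
    ~-transport⁻ {u} {v} u~v {α} = proj₂ (~⇒sameIv u v u~v α)

    reach-++-quotPath : ∀ {γ u β v} →
      I (toS A) γ u → Path (quot A _~_ eq) u β v → I (toS A) (γ ++ β) v
    reach-++-quotPath {γ} {v = v} p (nil u~v) =
      subst (λ δ → I (toS A) δ v) (sym (++-identityʳ γ)) (~-transport u~v p)
    reach-++-quotPath {γ} {β = a ∷ α} {v} p (cons (_ , _ , u′~u , w′~w , e) q) =
      subst (λ δ → I (toS A) δ v) (++-assoc γ [ a ] α)
        (reach-++-quotPath (~-transport w′~w (path-snoc A (~-transport⁻ u′~u p) e)) q)

    I⇔I/~ : ∀ α v → I (toS A) α v ⇔ I (quot A _~_ eq) α v
    I⇔I/~ α v = path⇒quotPath , reach-++-quotPath (nil refl)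

    Lang/~⇔Lang : ∀ α → Lang (quot A _~_ eq) α ⇔ Lang (toS A) α
    Lang/~⇔Lang α =
        (λ { (v , q , v′ , v′~v , f) → v′ , ~-transport⁻ v′~v (proj₂ (I⇔I/~ α v) q) , f })
      , (λ { (v , p , f) → v , path⇒quotPath p , v , ~-refl , f })

    SameReach/~⇔SameReach : ∀ α γ →
      SameReach (quot A _~_ eq) α γ ⇔ SameReach (toS A) α γ
    SameReach/~⇔SameReach α γ =
        (λ h v → proj₂ (⇔-cong (I⇔I/~ α v) (I⇔I/~ γ v)) (h v))
      , (λ h v → proj₁ (⇔-cong (I⇔I/~ α v) (I⇔I/~ γ v)) (h v))

lemma14 : ∀ {k : ℕ} (A : NFA k) → Trim A →
    (_~_ : Rel (Fin (NFA.n A)) 0ℓ) (eq : IsEquivalence _~_) →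
    (∀ u v → u ~ v → ∀ α → Iv (toS A) u α ⇔ Iv (toS A) v α) →
    (∀ α v → I (toS A) α v ⇔ I (quot A _~_ eq) α v)
    × (∀ v α → Iv (toS A) v α ⇔ Iv (quot A _~_ eq) v α)
    × (∀ α → Lang (quot A _~_ eq) α ⇔ Lang (toS A) α)
    × PowIso (quot A _~_ eq) (toS A)
lemma14 A _ _~_ eq ~⇒sameIv =
    I⇔I/~ A _~_ eq ~⇒sameIv
  , (λ v α → I⇔I/~ A _~_ eq ~⇒sameIv α v)
  , Lang/~⇔Lang A _~_ eq ~⇒sameIv
  , sameLang∧sameReach⇒PowIso (Lang/~⇔Lang A _~_ eq ~⇒sameIv)
                              (SameReach/~⇔SameReach A _~_ eq ~⇒sameIv)
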